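{- Every finite simple graph $G$ with no isolated vertex has a double coalition partition ($dc$-partition).
   Context: Let $G=(V,E)$ be a finite simple undirected graph, with $N[v]=\{v\}\cup N(v)$ the closed neighborhood of $v$. A set $D\subseteq V$ is a double dominating set of $G$ if $|N[v]\cap D|\ge 2$ for every $v\in V$ (i.e. each vertex of $D$ has at least one neighbor in $D$ and each vertex of $V\setminus D$ has at least two neighbors in $D$). Two disjoint sets $V_1,V_2\subseteq V$ form a double coalition if neither $V_1$ nor $V_2$ is a double dominating set but $V_1\cup V_2$ is a double dominating set. A double coalition partition ($dc$-partition) of $G$ is a partition $\Pi=\{V_1,\dots,V_k\}$ of $V$ such that every $V_i\in\Pi$ is not a double dominating set and forms a double coalition with some other set $V_j\in\Pi$ (which is also not a double dominating set). -}

module Defs where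

open import Data.Nat using (ℕ; _≥_)
open import Data.Bool using (Bool; true; false)
open import Data.Fin using (Fin)
open import Data.Fin.Subset using (Subset; _∩_; _∪_; ∣_∣; _∈_; ⁅_⁆)
open import Data.Vec using (tabulate)
open import Data.Product using (Σ; ∃; _×_; _,_)
open import Relation.Nullary using (¬_)
open import Relation.Binary.PropositionalEquality using (_≡_; _≢_)

record Graph (n : ℕ) : Set where
  field
    adj   : Fin n → Fin n → Bool
    sym   : ∀ u v → adj u v ≡ adj v u
    irrefl : ∀ v → adj v v ≡ false
open Graph public

N : ∀ {n} → Graph n → Fin n → Subset n
N G v = tabulate (adj G v)

N[_]_ : ∀ {n} → Graph n → Fin n → Subset n
N[ G ] v = ⁅ v ⁆ ∪ N G v

IsDoubleDominating : ∀ {n} → Graph n → Subset n → Set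
IsDoubleDominating G D = ∀ v → ∣ (N[ G ] v) ∩ D ∣ ≥ 2

NoIsolatedVertex : ∀ {n} → Graph n → Set
NoIsolatedVertex {n} G = ∀ (v : Fin n) → ∃ λ (u : Fin n) → adj G v u ≡ true

DoubleCoalition : ∀ {n} → Graph n → Subset n → Subset n → Set
DoubleCoalition G A B =
  ¬ IsDoubleDominating G A × ¬ IsDoubleDominating G B × IsDoubleDominating G (A ∪ B)

-- A partition of Fin n into k blocks, given by a block-assignment map
-- f : Fin n → Fin k that is surjective (all blocks nonempty).
block : ∀ {n k} → (Fin n → Fin k) → Fin k → Subset n
block f i = tabulate (λ v → isYes (f v ≟ i))
  where
    open import Data.Fin using (_≟_)
    open import Relation.Nullary using (isYes)

record DCPartition {n} (G : Graph n) : Set where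
  field
    k        : ℕ
    f        : Fin n → Fin k
    nonempty : ∀ (i : Fin k) → ∃ λ (v : Fin n) → f v ≡ i
    notDD    : ∀ (i : Fin k) → ¬ IsDoubleDominating G (block f i)
    partner  : ∀ (i : Fin k) → ∃ λ (j : Fin k) →
                 j ≢ i × DoubleCoalition G (block f i) (block f j)

module Submission where

-- Grow {v₀} greedily into a maximal set A that is not double dominating.
-- Without isolated vertices V itself is double dominating, so some vertex lies
-- outside A, and by maximality A ∪ {u} is double dominating for every u ∉ A.
-- Hence A together with the singletons outside A is a dc-partition: singletons
-- are never double dominating, every singleton {u} pairs with A, and A pairs
-- with any of them.

open import Level using (Level)
open import Data.Nat using (ℕ; zero; suc; _≤_; _≤?_; s≤s)
open import Data.Nat.Properties using (≤-trans; 1+n≰n; module ≤-Reasoning)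
open import Data.Bool using (Bool; true)
open import Data.Bool.Properties using (T-≡)
open import Data.Fin using (Fin; zero; suc; _≟_)
open import Data.Fin.Properties using (suc-injective; any?; all?; ¬∀⟶∃¬)
open import Data.Fin.Subset
  using (Subset; _∈_; _∉_; _⊆_; _∪_; _∩_; _-_; ⁅_⁆; ⊤; ∣_∣)
open import Data.Fin.Subset.Properties
  using (_∈?_; x∈p∩q⁺; x∈p∩q⁻; x∈p∪q⁺; x∈p∪q⁻; ∈⊤; x∈⁅x⁆; x∈⁅y⁆⇒x≡y; ∣⁅x⁆∣≡1;
         p⊆q⇒∣p∣≤∣q∣; ∣p∩q∣≤∣q∣; x∈p∧x≢y⇒x∈p-y; x∈p⇒∣p-x∣<∣p∣;
         ⊆-trans; ⊆-reflexive; ∪-comm)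
open import Data.List using (List; []; _∷_; allFin)
open import Data.List.Membership.Propositional using () renaming (_∈_ to _∈ₗ_)
open import Data.List.Membership.Propositional.Properties using (∈-allFin)
open import Data.List.Relation.Unary.Any using (here; there)
open import Data.Product using (∃; _×_; _,_; proj₁; proj₂; map₂)
open import Data.Sum using (_⊎_; inj₁; inj₂)
open import Data.Vec using (tabulate)
open import Data.Vec.Properties using (lookup∘tabulate; lookup⇒[]=; []=⇒lookup; tabulate-cong)
open import Function using (_∘_; id)
open import Function.Bundles using (Equivalence; _⇔_; mk⇔)
open import Function.Definitions using (Injective; StrictlySurjective)
open import Relation.Nullary using (¬_; yes; no; contradiction; isYes; toWitness; toSum)
open import Relation.Nullary.Decidable using (isYes≗does; dec-true; does-⇔)
open import Relation.Unary using (Pred; Decidable)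
open import Relation.Binary.PropositionalEquality
  using (_≡_; _≢_; refl; sym; trans; cong; subst₂)

open import Defs hiding (sym)

private
  variable
    ℓ : Level
    n m : ℕ

record Enumeration (P : Pred (Fin n) ℓ) : Set ℓ where
  field
    size            : ℕ
    index           : Fin size → Fin n
    index-injective : Injective _≡_ _≡_ index
    index-sound     : ∀ i → P (index i)
    index-complete  : ∀ {x} → P x → ∃ λ i → index i ≡ x

module _ {P : Pred (Fin (suc n)) ℓ} (e : Enumeration (P ∘ suc)) where
  open Enumeration e

  enumeration-with-zero : P zero → Enumeration P
  enumeration-with-zero P0 = record
    { size = suc size ; index = index′ ; index-injective = index′-injective
    ; index-sound = index′-sound ; index-complete = index′-complete }
    where
      index′ : Fin (suc size) → Fin (suc n)
      index′ zero    = zero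
      index′ (suc i) = suc (index i)

      index′-injective : Injective _≡_ _≡_ index′
      index′-injective {zero}  {zero}  _  = refl
      index′-injective {suc i} {suc j} eq = cong suc (index-injective (suc-injective eq))

      index′-sound : ∀ i → P (index′ i)
      index′-sound zero    = P0
      index′-sound (suc i) = index-sound i

      index′-complete : ∀ {x} → P x → ∃ λ i → index′ i ≡ x
      index′-complete {zero}  _  = zero , refl
      index′-complete {suc x} Px with i , eq ← index-complete Px = suc i , cong suc eq

  enumeration-without-zero : ¬ P zero → Enumeration P
  enumeration-without-zero ¬P0 = record
    { size = size ; index = suc ∘ index ; index-injective = index-injective ∘ suc-injective
    ; index-sound = index-sound ; index-complete = complete }
    where
      complete : ∀ {x} → P x → ∃ λ i → suc (index i) ≡ x
      complete {zero}  P0 = contradiction P0 ¬P0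
      complete {suc x} Px with i , eq ← index-complete Px = i , cong suc eq

enumerate : {P : Pred (Fin n) ℓ} → Decidable P → Enumeration P
enumerate {n = zero}  P? = record
  { size = 0 ; index = λ () ; index-injective = λ { {()} }
  ; index-sound = λ () ; index-complete = λ { {()} } }
enumerate {n = suc n} P? with P? zero
... | yes P0  = enumeration-with-zero (enumerate (P? ∘ suc)) P0
... | no  ¬P0 = enumeration-without-zero (enumerate (P? ∘ suc)) ¬P0

record ImageFactorisation (g : Fin n → Fin m) : Set where
  field
    k            : ℕ
    f            : Fin n → Fin k
    ι            : Fin k → Fin m
    f-surjective : StrictlySurjective _≡_ f
    ι-injective  : Injective _≡_ _≡_ ι
    factorises   : ∀ v → ι (f v) ≡ g v

  same-f⇔same-g : ∀ {u v} → f u ≡ f v ⇔ g u ≡ g v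
  same-f⇔same-g {u} {v} = mk⇔
    (λ eq → trans (sym (factorises u)) (trans (cong ι eq) (factorises v)))
    (λ eq → ι-injective (trans (factorises u) (trans eq (sym (factorises v)))))

  block-f≡block-g : ∀ v → block f (f v) ≡ block g (g v)
  block-f≡block-g v = tabulate-cong λ w →
    trans (isYes≗does (f w ≟ f v))
          (trans (does-⇔ same-f⇔same-g (f w ≟ f v) (g w ≟ g v)) (sym (isYes≗does (g w ≟ g v))))

imageFactorisation : (g : Fin n → Fin m) → ImageFactorisation g
imageFactorisation {n} g = record
  { k = size ; f = f ; ι = index ; f-surjective = f-surjective
  ; ι-injective = index-injective ; factorises = factorises }
  where
    open Enumeration (enumerate (λ x → any? (λ v → g v ≟ x)))

    f : Fin n → Fin size
    f v = proj₁ (index-complete (v , refl))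

    factorises : ∀ v → index (f v) ≡ g v
    factorises v = proj₂ (index-complete (v , refl))

    f-surjective : StrictlySurjective _≡_ f
    f-surjective i with v , gv≡ιi ← index-sound i =
      v , index-injective (trans (factorises v) gv≡ιi)

∈-tabulate⁺ : ∀ (p : Fin n → Bool) {v} → p v ≡ true → v ∈ tabulate p
∈-tabulate⁺ p {v} pv≡true = lookup⇒[]= v (tabulate p) (trans (lookup∘tabulate p v) pv≡true)

∈-tabulate⁻ : ∀ (p : Fin n → Bool) {v} → v ∈ tabulate p → p v ≡ true
∈-tabulate⁻ p {v} v∈p = trans (sym (lookup∘tabulate p v)) ([]=⇒lookup v∈p)

∈-block⁺ : ∀ (g : Fin n → Fin m) {v x} → g v ≡ x → v ∈ block g x
∈-block⁺ g {v} {x} gv≡x =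
  ∈-tabulate⁺ (λ w → isYes (g w ≟ x)) (trans (isYes≗does (g v ≟ x)) (dec-true (g v ≟ x) gv≡x))

∈-block⁻ : ∀ (g : Fin n → Fin m) {v x} → v ∈ block g x → g v ≡ x
∈-block⁻ g v∈block = toWitness (Equivalence.from T-≡ (∈-tabulate⁻ _ v∈block))

∪-mono-⊆ : ∀ {p p′ q q′ : Subset n} → p ⊆ p′ → q ⊆ q′ → p ∪ q ⊆ p′ ∪ q′
∪-mono-⊆ {p = p} {q = q} p⊆p′ q⊆q′ x∈p∪q with x∈p∪q⁻ p q x∈p∪q
... | inj₁ x∈p = x∈p∪q⁺ (inj₁ (p⊆p′ x∈p))
... | inj₂ x∈q = x∈p∪q⁺ (inj₂ (q⊆q′ x∈q))

∩-monoʳ-⊆ : ∀ {p q r : Subset n} → p ⊆ q → r ∩ p ⊆ r ∩ q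
∩-monoʳ-⊆ {p = p} {r = r} p⊆q x∈r∩p with x∈r , x∈p ← x∈p∩q⁻ r p x∈r∩p = x∈p∩q⁺ (x∈r , p⊆q x∈p)

2≤∣p∣ : ∀ {p : Subset n} {x y} → x ∈ p → y ∈ p → x ≢ y → 2 ≤ ∣ p ∣
2≤∣p∣ {p = p} {x} {y} x∈p y∈p x≢y = begin
  2              ≡⟨ cong suc (sym (∣⁅x⁆∣≡1 y)) ⟩
  suc ∣ ⁅ y ⁆ ∣  ≤⟨ s≤s (p⊆q⇒∣p∣≤∣q∣ ⁅y⁆⊆p-x) ⟩
  suc ∣ p - x ∣  ≤⟨ x∈p⇒∣p-x∣<∣p∣ x∈p ⟩
  ∣ p ∣          ∎
  where
    open ≤-Reasoning
    ⁅y⁆⊆p-x : ⁅ y ⁆ ⊆ p - x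
    ⁅y⁆⊆p-x z∈⁅y⁆ with refl ← x∈⁅y⁆⇒x≡y y z∈⁅y⁆ = x∈p∧x≢y⇒x∈p-y y∈p (x≢y ∘ sym)

record MaximalAvoiding (Q : Pred (Subset n) ℓ) (S : Subset n) : Set ℓ where
  field
    set     : Subset n
    seed⊆   : S ⊆ set
    avoids  : ¬ Q set
    maximal : ∀ w → w ∈ set ⊎ Q (set ∪ ⁅ w ⁆)

module _ {Q : Pred (Subset n) ℓ} (Q? : Decidable Q)
         (Q-mono : ∀ {p q} → p ⊆ q → Q p → Q q) where

  saturate : ∀ (ws : List (Fin n)) {S} → ¬ Q S →
             ∃ λ A → S ⊆ A × ¬ Q A × (∀ {w} → w ∈ₗ ws → w ∈ A ⊎ Q (A ∪ ⁅ w ⁆))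
  saturate []       {S} ¬QS = S , id , ¬QS , λ ()
  saturate (w ∷ ws) {S} ¬QS with Q? (S ∪ ⁅ w ⁆)
  ... | yes QS+w with A , S⊆A , ¬QA , max ← saturate ws ¬QS =
    A , S⊆A , ¬QA , λ { (here refl) → inj₂ (Q-mono (∪-mono-⊆ S⊆A id) QS+w)
                      ; (there w∈ws) → max w∈ws }
  ... | no ¬QS+w with A , S+w⊆A , ¬QA , max ← saturate ws ¬QS+w =
    A , S+w⊆A ∘ x∈p∪q⁺ ∘ inj₁ , ¬QA ,
    λ { (here refl) → inj₁ (S+w⊆A (x∈p∪q⁺ (inj₂ (x∈⁅x⁆ w))))
      ; (there w∈ws) → max w∈ws }

  maximal-avoiding : ∀ {S} → ¬ Q S → MaximalAvoiding Q S
  maximal-avoiding ¬QS with A , S⊆A , ¬QA , max ← saturate (allFin _) ¬QS =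
    record { set = A ; seed⊆ = S⊆A ; avoids = ¬QA ; maximal = λ w → max (∈-allFin w) }

module _ (G : Graph n) where

  isDoubleDominating? : Decidable (IsDoubleDominating G)
  isDoubleDominating? D = all? (λ v → 2 ≤? ∣ (N[ G ] v) ∩ D ∣)

  isDoubleDominating-mono : ∀ {p q} → p ⊆ q → IsDoubleDominating G p → IsDoubleDominating G q
  isDoubleDominating-mono p⊆q p-dd v = ≤-trans (p-dd v) (p⊆q⇒∣p∣≤∣q∣ (∩-monoʳ-⊆ {r = N[ G ] v} p⊆q))

  ⁅⁆-notDoubleDominating : ∀ w → ¬ IsDoubleDominating G ⁅ w ⁆
  ⁅⁆-notDoubleDominating w dd = 1+n≰n (begin
    2                        ≤⟨ dd w ⟩
    ∣ (N[ G ] w) ∩ ⁅ w ⁆ ∣   ≤⟨ ∣p∩q∣≤∣q∣ (N[ G ] w) ⁅ w ⁆ ⟩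
    ∣ ⁅ w ⁆ ∣                ≡⟨ ∣⁅x⁆∣≡1 w ⟩
    1                        ∎)
    where open ≤-Reasoning

  ⊤-isDoubleDominating : NoIsolatedVertex G → IsDoubleDominating G ⊤
  ⊤-isDoubleDominating no-isolated v with u , v~u ← no-isolated v =
    2≤∣p∣ (x∈p∩q⁺ (x∈p∪q⁺ (inj₁ (x∈⁅x⁆ v)) , ∈⊤))
          (x∈p∩q⁺ (x∈p∪q⁺ (inj₂ (∈-tabulate⁺ (adj G v) v~u)) , ∈⊤))
          v≢u
    where
      v≢u : v ≢ u
      v≢u refl with () ← trans (sym v~u) (irrefl G v)

  -- A DCPartition must index its blocks by some Fin k with none empty; factoring
  -- the labelling through its image removes both constraints.
  dcPartition-fromLabelling :
    (g : Fin n → Fin m) →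
    (∀ v → ¬ IsDoubleDominating G (block g (g v))) →
    (∀ v → ∃ λ u → g u ≢ g v × IsDoubleDominating G (block g (g v) ∪ block g (g u))) →
    DCPartition G
  dcPartition-fromLabelling g class-notDD class-partner = record
    { k = k ; f = f ; nonempty = f-surjective ; notDD = notDD ; partner = partner }
    where
      open ImageFactorisation (imageFactorisation g)

      notDD : ∀ i → ¬ IsDoubleDominating G (block f i)
      notDD i with v , refl ← f-surjective i rewrite block-f≡block-g v = class-notDD v

      partner : ∀ i → ∃ λ j → j ≢ i × DoubleCoalition G (block f i) (block f j)
      partner i with v , refl ← f-surjective i with u , gu≢gv , dd ← class-partner v =
        f u , gu≢gv ∘ Equivalence.to same-f⇔same-g , notDD (f v) , notDD (f u) ,
        subst₂ (λ X Y → IsDoubleDominating G (X ∪ Y))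
               (sym (block-f≡block-g v)) (sym (block-f≡block-g u)) dd

module _ (G : Graph n) (no-isolated : NoIsolatedVertex G) (v₀ : Fin n) where

  -- Opaque so that A never unfolds into the greedy computation that produced it.
  opaque
    maximal-non-dd : MaximalAvoiding (IsDoubleDominating G) ⁅ v₀ ⁆
    maximal-non-dd = maximal-avoiding (isDoubleDominating? G) (isDoubleDominating-mono G)
                                      (⁅⁆-notDoubleDominating G v₀)

  open MaximalAvoiding maximal-non-dd renaming (set to A)

  v₀∈A : v₀ ∈ A
  v₀∈A = seed⊆ (x∈⁅x⁆ v₀)

  outsider : ∃ λ u → u ∉ A
  outsider = ¬∀⟶∃¬ _ (_∈ A) (_∈? A) λ all∈A →
    avoids (isDoubleDominating-mono G (λ {v} _ → all∈A v) (⊤-isDoubleDominating G no-isolated))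

  extension-isDoubleDominating : ∀ {u} → u ∉ A → IsDoubleDominating G (A ∪ ⁅ u ⁆)
  extension-isDoubleDominating {u} u∉A with maximal u
  ... | inj₁ u∈A = contradiction u∈A u∉A
  ... | inj₂ dd  = dd

  label : Fin n → Fin (suc n)
  label v with v ∈? A
  ... | yes _ = zero
  ... | no  _ = suc v

  label-∈ : ∀ {v} → v ∈ A → label v ≡ zero
  label-∈ {v} v∈A with v ∈? A
  ... | yes _   = refl
  ... | no  v∉A = contradiction v∈A v∉A

  label-∉ : ∀ {v} → v ∉ A → label v ≡ suc v
  label-∉ {v} v∉A with v ∈? A
  ... | yes v∈A = contradiction v∈A v∉A
  ... | no  _   = refl

  label≡zero⇒∈ : ∀ {v} → label v ≡ zero → v ∈ A
  label≡zero⇒∈ {v} eq with v ∈? A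
  ... | yes v∈A = v∈A

  label≡suc⇒≡ : ∀ {v u} → label v ≡ suc u → v ≡ u
  label≡suc⇒≡ {v} eq with v ∈? A
  ... | no _ = suc-injective eq

  A⊆block-zero : A ⊆ block label zero
  A⊆block-zero = ∈-block⁺ label ∘ label-∈

  block-zero⊆A : block label zero ⊆ A
  block-zero⊆A = label≡zero⇒∈ ∘ ∈-block⁻ label

  ⁅⁆⊆block-suc : ∀ {v} → v ∉ A → ⁅ v ⁆ ⊆ block label (suc v)
  ⁅⁆⊆block-suc v∉A w∈⁅v⁆ with refl ← x∈⁅y⁆⇒x≡y _ w∈⁅v⁆ = ∈-block⁺ label (label-∉ v∉A)

  block-suc⊆⁅⁆ : ∀ {v} → block label (suc v) ⊆ ⁅ v ⁆
  block-suc⊆⁅⁆ w∈block with refl ← label≡suc⇒≡ (∈-block⁻ label w∈block) = x∈⁅x⁆ _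

  class-notDoubleDominating : ∀ v → ¬ IsDoubleDominating G (block label (label v))
  class-notDoubleDominating v with toSum (v ∈? A)
  ... | inj₁ v∈A rewrite label-∈ v∈A =
    avoids ∘ isDoubleDominating-mono G block-zero⊆A
  ... | inj₂ v∉A rewrite label-∉ v∉A =
    ⁅⁆-notDoubleDominating G v ∘ isDoubleDominating-mono G block-suc⊆⁅⁆

  partner-of-A : ∀ {v u} → v ∈ A → u ∉ A →
    label u ≢ label v × IsDoubleDominating G (block label (label v) ∪ block label (label u))
  partner-of-A v∈A u∉A rewrite label-∈ v∈A | label-∉ u∉A =
    (λ ()) ,
    isDoubleDominating-mono G (∪-mono-⊆ A⊆block-zero (⁅⁆⊆block-suc u∉A))
      (extension-isDoubleDominating u∉A)

  partner-of-singleton : ∀ {v} → v ∉ A →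
    label v₀ ≢ label v × IsDoubleDominating G (block label (label v) ∪ block label (label v₀))
  partner-of-singleton {v} v∉A rewrite label-∉ v∉A | label-∈ v₀∈A =
    (λ ()) ,
    isDoubleDominating-mono G
      (⊆-trans (⊆-reflexive (∪-comm A ⁅ v ⁆)) (∪-mono-⊆ (⁅⁆⊆block-suc v∉A) A⊆block-zero))
      (extension-isDoubleDominating v∉A)

  class-partner : ∀ v → ∃ λ u →
    label u ≢ label v × IsDoubleDominating G (block label (label v) ∪ block label (label u))
  class-partner v with toSum (v ∈? A)
  ... | inj₁ v∈A = map₂ (partner-of-A v∈A) outsider
  ... | inj₂ v∉A = v₀ , partner-of-singleton v∉A

  dcPartition : DCPartition G
  dcPartition = dcPartition-fromLabelling G label class-notDoubleDominating class-partner

mainTheorem1 : ∀ (n : ℕ) (G : Graph n) → NoIsolatedVertex G → DCPartition G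
mainTheorem1 zero    G _           =
  record { k = 0 ; f = λ () ; nonempty = λ () ; notDD = λ () ; partner = λ () }
mainTheorem1 (suc n) G no-isolated = dcPartition G no-isolated zero
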